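{- Let $n\ge 1$ and let $K_n$ be the complete graph on $n$ vertices. The eigenvectors of $L^{(2)}_{K_n}$ are \[ \mathbf{v}_j=(1,\omega^j,\omega^{2j},\dots,\omega^{(n-1)j})^T,\qquad 0\le j\le n-1, \] where $\omega=\exp(2\pi i/n)$, with corresponding eigenvalues \[ \lambda_j=\begin{cases}0 & j=0,\\ \frac{1}{12}n(18-n) & \text{otherwise.}\end{cases} \]
   Context: For a simple graph $G$ with adjacency matrix $A_G$ and degree matrix $D_G$ (diagonal matrix of vertex degrees), let $A'=\frac{1}{12}\left(16A_G-A_G^2+D_G\right)$ and let $D'$ be the diagonal matrix whose $(i,i)$ entry is the sum of the entries of the $i$th row of $A'$. The $2$-Laplacian of $G$ is $L^{(2)}_G=D'-A'$. -}

module Defs where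

open import Level using (_⊔_)
open import Algebra.Bundles using (CommutativeRing)
open import Data.Nat using (ℕ; zero; suc; _<_)
import Data.Nat as ℕ
open import Data.Fin using (Fin; toℕ; _≟_)
import Data.Fin as Fin
open import Data.Bool using (Bool; true; false; not; if_then_else_)
open import Data.Sum using (_⊎_)
open import Relation.Nullary using (¬_)
open import Relation.Nullary.Decidable using (⌊_⌋)
open import Relation.Binary.PropositionalEquality using (_≡_)

record SimpleGraph (n : ℕ) : Set where
  field
    adj       : Fin n → Fin n → Bool
    adj-sym   : ∀ i j → adj i j ≡ adj j i
    adj-irref : ∀ i → adj i i ≡ false

open SimpleGraph public

completeGraph : (n : ℕ) → SimpleGraph n
completeGraph n = record
  { adj       = λ i j → not ⌊ i ≟ j ⌋
  ; adj-sym   = sym'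
  ; adj-irref = irr
  }
  where
    open import Relation.Nullary using (yes; no)
    open import Relation.Binary.PropositionalEquality using (refl; sym)
    sym' : ∀ i j → not ⌊ i ≟ j ⌋ ≡ not ⌊ j ≟ i ⌋
    sym' i j with i ≟ j | j ≟ i
    ... | yes _ | yes _ = refl
    ... | no _  | no _  = refl
    ... | yes p | no q  = Data.Empty.⊥-elim (q (sym p)) where import Data.Empty
    ... | no p  | yes q = Data.Empty.⊥-elim (p (sym q)) where import Data.Empty
    irr : ∀ i → not ⌊ i ≟ i ⌋ ≡ false
    irr i with i ≟ i
    ... | yes _ = refl
    ... | no p  = Data.Empty.⊥-elim (p refl) where import Data.Empty

module _ {c ℓ} (R : CommutativeRing c ℓ) where
  open CommutativeRing R
  import Algebra.Bundles
  open import Algebra.Properties.Monoid.Sum +-monoid using (sum)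
  open import Algebra.Definitions.RawMonoid +-rawMonoid using (_×_)
  open import Algebra.Definitions.RawSemiring (Algebra.Bundles.Semiring.rawSemiring semiring) using (_^_)

  Matrix : ℕ → Set c
  Matrix n = Fin n → Fin n → Carrier

  Vect : ℕ → Set c
  Vect n = Fin n → Carrier

  indicator : Bool → Carrier
  indicator b = if b then 1# else 0#

  matMul : ∀ {n} → Matrix n → Matrix n → Matrix n
  matMul A B i j = sum (λ k → A i k * B k j)

  matVec : ∀ {n} → Matrix n → Vect n → Vect n
  matVec A v i = sum (λ k → A i k * v k)

  diag : ∀ {n} → Vect n → Matrix n
  diag d i j = if ⌊ i ≟ j ⌋ then d i else 0#

  rowSum : ∀ {n} → Matrix n → Vect n
  rowSum A i = sum (λ k → A i k)

  adjMatrix : ∀ {n} → SimpleGraph n → Matrix n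
  adjMatrix G i j = indicator (adj G i j)

  degMatrix : ∀ {n} → SimpleGraph n → Matrix n
  degMatrix G = diag (rowSum (adjMatrix G))

  -- The scalar 1/12 is given as an element `inv12`
  -- (assumed in the statement to satisfy 12 * inv12 ≈ 1).
  A′ : ∀ {n} → Carrier → SimpleGraph n → Matrix n
  A′ inv12 G i j =
    inv12 * ((16 × 1#) * adjMatrix G i j
             - matMul (adjMatrix G) (adjMatrix G) i j
             + degMatrix G i j)

  D′ : ∀ {n} → Carrier → SimpleGraph n → Matrix n
  D′ inv12 G = diag (rowSum (A′ inv12 G))

  twoLaplacian : ∀ {n} → Carrier → SimpleGraph n → Matrix n
  twoLaplacian inv12 G i j = D′ inv12 G i j - A′ inv12 G i j

  IsInverseOf12 : Carrier → Set ℓ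
  IsInverseOf12 inv12 = (12 × 1#) * inv12 ≈ 1#

  IsEigenpair : ∀ {n} → Matrix n → Carrier → Vect n → Set ℓ
  IsEigenpair L λ′ v = ∀ i → matVec L v i ≈ λ′ * v i

  IsDomain : Set (c ⊔ ℓ)
  IsDomain = (¬ (1# ≈ 0#)) Data.Product.× (∀ x y → x * y ≈ 0# → (x ≈ 0#) ⊎ (y ≈ 0#))
    where import Data.Product

  IsPrimitiveRoot : ℕ → Carrier → Set ℓ
  IsPrimitiveRoot n ω = (ω ^ n ≈ 1#) Data.Product.× (∀ k → 0 < k → k < n → ¬ (ω ^ k ≈ 1#))
    where import Data.Product

  rootVector : ∀ {n} → Carrier → Fin n → Vect n
  rootVector ω j k = ω ^ (toℕ k ℕ.* toℕ j)

  eigenvalue : ∀ {n} → Carrier → Fin n → Carrier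
  eigenvalue inv12 Fin.zero = 0#
  eigenvalue {n} inv12 (Fin.suc _) = inv12 * ((n × 1#) * ((18 × 1#) - (n × 1#)))

-- For K_n the adjacency matrix is A = J − I, so A² = (n − 1)I + (n − 2)A and D = (n − 1)I.
-- Hence A′ = c·A with c = (18 − n)/12, and the 2-Laplacian is L = c(nI − J), so that
-- L v = c(n v − (Σ v)·1).  The all-ones vector v₀ has Σ v₀ = n and is in the kernel.
-- For 0 < j < n put x = ω^j: then (x − 1)·Σ_k x^k = x^n − 1 = 0 and x ≠ 1, so in a
-- domain Σ v_j = 0 and v_j has eigenvalue c·n = n(18 − n)/12.

module Submission where

open import Defs
open import Algebra.Bundles using (CommutativeRing; RawRing)
open import Algebra.Solver.Ring.AlmostCommutativeRing using (fromCommutativeRing; _-Raw-AlmostCommutative⟶_)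
open import Data.Bool using (true; false; not; if_then_else_)
open import Data.Empty using (⊥-elim)
open import Data.Fin as Fin using (Fin; toℕ; _≟_)
import Data.Fin.Properties as Fin
open import Data.Maybe using (Maybe; map)
open import Data.Nat as ℕ using (ℕ; zero; suc; _∸_; _≤_; _<_; s≤s; z≤n)
import Data.Nat.Properties as ℕ
open import Data.Product using (_,_) renaming (_×_ to _⊗_)
open import Data.Product.Properties using (≡-dec)
open import Data.Sum using ([_,_]′)
open import Level using (0ℓ)
open import Relation.Binary.Consequences using (dec⇒weaklyDec)
open import Relation.Binary.PropositionalEquality as ≡ using (_≡_)
open import Relation.Nullary.Decidable using (⌊_⌋; ⌊⌋-map′)

-- The ring solver of the library needs a coefficient ring mapping into R; the integers,
-- as pairs of naturals, map into every commutative ring.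
module IntegerCoefficients {c ℓ} (R : CommutativeRing c ℓ) where
  open CommutativeRing R
  open import Algebra.Properties.Ring ring using (x[y-z]≈xy-xz; [y-z]x≈yx-zx)
  open import Algebra.Properties.AbelianGroup +-abelianGroup using (⁻¹-anti-homo‿-; ⁻¹-∙-comm)
  open import Algebra.Properties.Group +-group using (ε⁻¹≈ε)
  open import Algebra.Properties.CommutativeSemigroup +-commutativeSemigroup using (interchange)
  open import Algebra.Properties.Semiring.Mult.TCOptimised semiring using (_×_; 1+×; ×-homo-+; ×1-homo-*)
  open import Relation.Binary.Reasoning.Setoid setoid

  [x-y]+[z-w]≈[x+z]-[y+w] : ∀ x y z w → (x - y) + (z - w) ≈ (x + z) - (y + w)
  [x-y]+[z-w]≈[x+z]-[y+w] x y z w = begin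
    (x - y) + (z - w)     ≈⟨ interchange x (- y) z (- w) ⟩
    (x + z) + (- y + - w) ≈⟨ +-congˡ (⁻¹-∙-comm y w) ⟩
    (x + z) - (y + w)     ∎

  [x-y][z-w]≈[xz+yw]-[xw+yz] : ∀ x y z w → (x - y) * (z - w) ≈ (x * z + y * w) - (x * w + y * z)
  [x-y][z-w]≈[xz+yw]-[xw+yz] x y z w = begin
    (x - y) * (z - w)                 ≈⟨ x[y-z]≈xy-xz (x - y) z w ⟩
    (x - y) * z - (x - y) * w         ≈⟨ +-cong ([y-z]x≈yx-zx z x y) (-‿cong ([y-z]x≈yx-zx w x y)) ⟩
    (x * z - y * z) - (x * w - y * w) ≈⟨ +-congˡ (⁻¹-anti-homo‿- (x * w) (y * w)) ⟩
    (x * z - y * z) + (y * w - x * w) ≈⟨ [x-y]+[z-w]≈[x+z]-[y+w] _ _ _ _ ⟩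
    (x * z + y * w) - (y * z + x * w) ≈⟨ +-congˡ (-‿cong (+-comm _ _)) ⟩
    (x * z + y * w) - (x * w + y * z) ∎

  [w+x]-[w+y]≈x-y : ∀ w x y → (w + x) - (w + y) ≈ x - y
  [w+x]-[w+y]≈x-y w x y = begin
    (w + x) - (w + y)   ≈⟨ [x-y]+[z-w]≈[x+z]-[y+w] w w x y ⟨
    (w - w) + (x - y)   ≈⟨ +-congʳ (-‿inverseʳ w) ⟩
    0# + (x - y)        ≈⟨ +-identityˡ _ ⟩
    x - y               ∎

  -- The pair (a , b) stands for the integer a − b; normalised pairs have a zero component.
  ℤ-normalise : ℕ → ℕ → ℕ ⊗ ℕ
  ℤ-normalise a b = a ∸ b , b ∸ a

  ℤ-rawRing : RawRing 0ℓ 0ℓ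
  ℤ-rawRing = record
    { Carrier = ℕ ⊗ ℕ
    ; _≈_     = _≡_
    ; _+_     = λ (a , b) (c , d) → ℤ-normalise (a ℕ.+ c) (b ℕ.+ d)
    ; _*_     = λ (a , b) (c , d) → ℤ-normalise (a ℕ.* c ℕ.+ b ℕ.* d) (a ℕ.* d ℕ.+ b ℕ.* c)
    ; -_      = λ (a , b) → b , a
    ; 0#      = 0 , 0
    ; 1#      = 1 , 0
    }

  -- Non-negative integers are sent to a × 1# itself, so the constants 0 and 1 denote 0# and 1# on the nose.
  ⟦_⟧ℤ : ℕ ⊗ ℕ → Carrier
  ⟦ a , zero  ⟧ℤ = a × 1#
  ⟦ a , suc b ⟧ℤ = a × 1# - suc b × 1#

  ⟦a,b⟧≈a-b : ∀ a b → ⟦ a , b ⟧ℤ ≈ a × 1# - b × 1#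
  ⟦a,b⟧≈a-b a zero    = sym (trans (+-congˡ ε⁻¹≈ε) (+-identityʳ _))
  ⟦a,b⟧≈a-b a (suc b) = refl

  ⟦ℤ-normalise⟧≈a-b : ∀ a b → ⟦ ℤ-normalise a b ⟧ℤ ≈ a × 1# - b × 1#
  ⟦ℤ-normalise⟧≈a-b zero    zero    = ⟦a,b⟧≈a-b 0 0
  ⟦ℤ-normalise⟧≈a-b zero    (suc b) = ⟦a,b⟧≈a-b 0 (suc b)
  ⟦ℤ-normalise⟧≈a-b (suc a) zero    = ⟦a,b⟧≈a-b (suc a) 0
  ⟦ℤ-normalise⟧≈a-b (suc a) (suc b) = begin
    ⟦ ℤ-normalise a b ⟧ℤ                  ≈⟨ ⟦ℤ-normalise⟧≈a-b a b ⟩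
    a × 1# - b × 1#                     ≈⟨ [w+x]-[w+y]≈x-y 1# _ _ ⟨
    (1# + a × 1#) - (1# + b × 1#)       ≈⟨ +-cong (1+× a 1#) (-‿cong (1+× b 1#)) ⟨
    suc a × 1# - suc b × 1#             ∎

  ⟦⟧ℤ-homomorphism : ℤ-rawRing -Raw-AlmostCommutative⟶ fromCommutativeRing R
  ⟦⟧ℤ-homomorphism = record
    { ⟦_⟧    = ⟦_⟧ℤ
    ; +-homo = λ (a , b) (c , d) → begin
        ⟦ ℤ-normalise (a ℕ.+ c) (b ℕ.+ d) ⟧ℤ          ≈⟨ ⟦ℤ-normalise⟧≈a-b (a ℕ.+ c) (b ℕ.+ d) ⟩
        (a ℕ.+ c) × 1# - (b ℕ.+ d) × 1#              ≈⟨ +-cong (×-homo-+ 1# a c) (-‿cong (×-homo-+ 1# b d)) ⟩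
        (a × 1# + c × 1#) - (b × 1# + d × 1#)        ≈⟨ [x-y]+[z-w]≈[x+z]-[y+w] _ _ _ _ ⟨
        (a × 1# - b × 1#) + (c × 1# - d × 1#)        ≈⟨ +-cong (⟦a,b⟧≈a-b a b) (⟦a,b⟧≈a-b c d) ⟨
        ⟦ a , b ⟧ℤ + ⟦ c , d ⟧ℤ                      ∎
    ; *-homo = λ (a , b) (c , d) →
        let [_] : ℕ → Carrier
            [ m ] = m × 1#
            ×1-homo-*+* : ∀ p q r s → (p ℕ.* q ℕ.+ r ℕ.* s) × 1# ≈ [ p ] * [ q ] + [ r ] * [ s ]
            ×1-homo-*+* p q r s = trans (×-homo-+ 1# (p ℕ.* q) (r ℕ.* s)) (+-cong (×1-homo-* p q) (×1-homo-* r s))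
        in begin
        ⟦ ℤ-normalise (a ℕ.* c ℕ.+ b ℕ.* d) (a ℕ.* d ℕ.+ b ℕ.* c) ⟧ℤ     ≈⟨ ⟦ℤ-normalise⟧≈a-b (a ℕ.* c ℕ.+ b ℕ.* d) (a ℕ.* d ℕ.+ b ℕ.* c) ⟩
        (a ℕ.* c ℕ.+ b ℕ.* d) × 1# - (a ℕ.* d ℕ.+ b ℕ.* c) × 1#       ≈⟨ +-cong (×1-homo-*+* a c b d) (-‿cong (×1-homo-*+* a d b c)) ⟩
        ([ a ] * [ c ] + [ b ] * [ d ]) - ([ a ] * [ d ] + [ b ] * [ c ]) ≈⟨ [x-y][z-w]≈[xz+yw]-[xw+yz] _ _ _ _ ⟨
        ([ a ] - [ b ]) * ([ c ] - [ d ])                                 ≈⟨ *-cong (⟦a,b⟧≈a-b a b) (⟦a,b⟧≈a-b c d) ⟨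
        ⟦ a , b ⟧ℤ * ⟦ c , d ⟧ℤ                                           ∎
    ; -‿homo = λ (a , b) → begin
        ⟦ b , a ⟧ℤ          ≈⟨ ⟦a,b⟧≈a-b b a ⟩
        b × 1# - a × 1#     ≈⟨ ⁻¹-anti-homo‿- _ _ ⟨
        - (a × 1# - b × 1#) ≈⟨ -‿cong (⟦a,b⟧≈a-b a b) ⟨
        - ⟦ a , b ⟧ℤ        ∎
    ; 0-homo = refl
    ; 1-homo = refl
    }

  ⟦⟧ℤ-≟ : ∀ p q → Maybe (⟦ p ⟧ℤ ≈ ⟦ q ⟧ℤ)
  ⟦⟧ℤ-≟ p q = map (λ { ≡.refl → refl }) (dec⇒weaklyDec (≡-dec ℕ._≟_ ℕ._≟_) p q)

  open import Algebra.Solver.Ring ℤ-rawRing (fromCommutativeRing R) ⟦⟧ℤ-homomorphism ⟦⟧ℤ-≟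
    public using (solve; _:=_; con; _:+_; _:*_; _:-_)

module _ {r ℓ} (R : CommutativeRing r ℓ) where
  open CommutativeRing R
  open IntegerCoefficients R
  open import Algebra.Properties.Semiring.Sum semiring
    using (sum; sum-cong-≋; ∑-distrib-+; *-distribˡ-sum; sum-replicate; sum-replicate-zero)
  open import Algebra.Definitions.RawMonoid +-rawMonoid using (_×_)
  open import Algebra.Properties.Semiring.Exp semiring using (_^_; ^-assocʳ; ^-congʳ; ^-congˡ)
  open import Algebra.Properties.AbelianGroup +-abelianGroup using (⁻¹-∙-comm)
  open import Algebra.Properties.Group +-group using (ε⁻¹≈ε; x∙y⁻¹≈ε⇒x≈y)
  open import Relation.Binary.Reasoning.Setoid setoid

  sum-neg : ∀ {m} (f : Fin m → Carrier) → sum (λ k → - f k) ≈ - sum f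
  sum-neg {zero}  f = sym ε⁻¹≈ε
  sum-neg {suc m} f = trans (+-congˡ (sum-neg (λ k → f (Fin.suc k)))) (⁻¹-∙-comm _ _)

  ∑-distrib-- : ∀ {m} (f g : Fin m → Carrier) → sum (λ k → f k - g k) ≈ sum f - sum g
  ∑-distrib-- f g = trans (∑-distrib-+ f (λ k → - g k)) (+-congˡ (sum-neg g))

  δ : ∀ {m} → Fin m → Fin m → Carrier
  δ i k = indicator R ⌊ i ≟ k ⌋

  δ-suc : ∀ {m} (i k : Fin m) → δ (Fin.suc i) (Fin.suc k) ≡ δ i k
  δ-suc i k = ≡.cong (indicator R) (⌊⌋-map′ _ _ (i ≟ k))

  ∑-δ : ∀ {m} (i : Fin m) (f : Fin m → Carrier) → sum (λ k → δ i k * f k) ≈ f i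
  ∑-δ {suc m} Fin.zero f = begin
    1# * f Fin.zero + sum (λ k → 0# * f (Fin.suc k))
      ≈⟨ +-cong (*-identityˡ _) (sum-cong-≋ (λ k → zeroˡ (f (Fin.suc k)))) ⟩
    f Fin.zero + sum (λ (_ : Fin m) → 0#)
      ≈⟨ +-congˡ (sum-replicate-zero m) ⟩
    f Fin.zero + 0#
      ≈⟨ +-identityʳ _ ⟩
    f Fin.zero
      ∎
  ∑-δ {suc m} (Fin.suc i) f = begin
    0# * f Fin.zero + sum (λ k → δ (Fin.suc i) (Fin.suc k) * f (Fin.suc k))
      ≈⟨ +-cong (zeroˡ _) (sum-cong-≋ (λ k → *-congʳ {f (Fin.suc k)} (reflexive (δ-suc i k)))) ⟩
    0# + sum (λ k → δ i k * f (Fin.suc k))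
      ≈⟨ +-identityˡ _ ⟩
    sum (λ k → δ i k * f (Fin.suc k))
      ≈⟨ ∑-δ i (λ k → f (Fin.suc k)) ⟩
    f (Fin.suc i)
      ∎

  ∑-δ≈1 : ∀ {m} (i : Fin m) → sum (δ i) ≈ 1#
  ∑-δ≈1 i = begin
    sum (δ i)                ≈⟨ sum-cong-≋ (λ k → sym (*-identityʳ (δ i k))) ⟩
    sum (λ k → δ i k * 1#)   ≈⟨ ∑-δ i (λ _ → 1#) ⟩
    1#                       ∎

  ∑-1-δ : ∀ {m} (i : Fin m) → sum (λ k → 1# - δ i k) ≈ m × 1# - 1#
  ∑-1-δ {m} i = begin
    sum (λ k → 1# - δ i k)                ≈⟨ ∑-distrib-- (λ _ → 1#) (δ i) ⟩
    sum (λ (_ : Fin m) → 1#) - sum (δ i)  ≈⟨ +-cong (sum-replicate m) (-‿cong (∑-δ≈1 i)) ⟩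
    m × 1# - 1#                           ∎

  indicator-not : ∀ b → indicator R (not b) ≈ 1# - indicator R b
  indicator-not true  = sym (-‿inverseʳ 1#)
  indicator-not false = sym (trans (+-congˡ ε⁻¹≈ε) (+-identityʳ 1#))

  if-then-0≈indicator* : ∀ b x → (if b then x else 0#) ≈ indicator R b * x
  if-then-0≈indicator* true  x = sym (*-identityˡ x)
  if-then-0≈indicator* false x = sym (zeroˡ x)

  diag≈δ* : ∀ {m} (d : Vect R m) i k → diag R d i k ≈ δ i k * d i
  diag≈δ* d i k = if-then-0≈indicator* ⌊ i ≟ k ⌋ (d i)

  matVec-aI-bJ : ∀ {m} {M : Matrix R m} a b → (∀ i k → M i k ≈ a * δ i k - b) →
                 ∀ v i → matVec R M v i ≈ a * v i - b * sum v
  matVec-aI-bJ {M = M} a b M≈aI-bJ v i = begin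
    sum (λ k → M i k * v k)                       ≈⟨ sum-cong-≋ (λ k → trans (*-congʳ (M≈aI-bJ i k)) (distribute (δ i k) (v k))) ⟩
    sum (λ k → a * (δ i k * v k) - b * v k)       ≈⟨ ∑-distrib-- (λ k → a * (δ i k * v k)) (λ k → b * v k) ⟩
    sum (λ k → a * (δ i k * v k)) - sum (λ k → b * v k)
                                                  ≈⟨ +-cong (*-distribˡ-sum a (λ k → δ i k * v k)) (-‿cong (*-distribˡ-sum b v)) ⟨
    a * sum (λ k → δ i k * v k) - b * sum v       ≈⟨ +-congʳ (*-congˡ (∑-δ i v)) ⟩
    a * v i - b * sum v                           ∎
    where
    distribute : ∀ d x → (a * d - b) * x ≈ a * (d * x) - b * x
    distribute = solve 4 (λ a b d x → (a :* d :- b) :* x := a :* (d :* x) :- b :* x) refl a b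

  module CompleteGraph (n : ℕ) where

    N : Carrier
    N = n × 1#

    A : Matrix R n
    A = adjMatrix R (completeGraph n)

    A≈1-δ : ∀ i k → A i k ≈ 1# - δ i k
    A≈1-δ i k = indicator-not ⌊ i ≟ k ⌋

    A-symmetric : ∀ i k → A i k ≈ A k i
    A-symmetric i k = reflexive (≡.cong (indicator R) (adj-sym (completeGraph n) i k))

    degree : ∀ i → rowSum R A i ≈ N - 1#
    degree i = trans (sum-cong-≋ (A≈1-δ i)) (∑-1-δ i)

    degMatrix≈δ* : ∀ i k → degMatrix R (completeGraph n) i k ≈ δ i k * (N - 1#)
    degMatrix≈δ* i k = trans (diag≈δ* (rowSum R A) i k) (*-congˡ (degree i))

    A²≈ : ∀ i k → matMul R A A i k ≈ (N - 1#) - (1# - δ i k)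
    A²≈ i k = begin
      sum (λ l → A i l * A l k)                      ≈⟨ sum-cong-≋ (λ l → *-cong (A≈1-δ i l) (A-symmetric l k)) ⟩
      sum (λ l → (1# - δ i l) * A k l)               ≈⟨ sum-cong-≋ (λ l → [1-d]x≈x-dx (δ i l) (A k l)) ⟩
      sum (λ l → A k l - δ i l * A k l)              ≈⟨ ∑-distrib-- (A k) (λ l → δ i l * A k l) ⟩
      sum (A k) - sum (λ l → δ i l * A k l)          ≈⟨ +-cong (degree k) (-‿cong (∑-δ i (A k))) ⟩
      (N - 1#) - A k i                               ≈⟨ +-congˡ (-‿cong (trans (A-symmetric k i) (A≈1-δ i k))) ⟩
      (N - 1#) - (1# - δ i k)                        ∎
      where
      [1-d]x≈x-dx : ∀ d x → (1# - d) * x ≈ x - d * x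
      [1-d]x≈x-dx = solve 2 (λ d x → (con (1 , 0) :- d) :* x := x :- d :* x) refl

    module _ (inv12 : Carrier) where

      c : Carrier
      c = inv12 * (18 × 1# - N)

      A′≈c[1-δ] : ∀ i k → A′ R inv12 (completeGraph n) i k ≈ c * (1# - δ i k)
      A′≈c[1-δ] i k = begin
        inv12 * (16 × 1# * A i k - matMul R A A i k + degMatrix R (completeGraph n) i k)
          ≈⟨ *-congˡ (+-cong (+-cong (*-congˡ (A≈1-δ i k)) (-‿cong (A²≈ i k))) (degMatrix≈δ* i k)) ⟩
        inv12 * (16 × 1# * (1# - δ i k) - ((N - 1#) - (1# - δ i k)) + δ i k * (N - 1#))
          ≈⟨ collect (16 × 1#) (δ i k) ⟩
        c * (1# - δ i k)
          ∎
        where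
        -- 18 × 1# unfolds definitionally to 1# + (1# + 16 × 1#)
        collect : ∀ s d → inv12 * (s * (1# - d) - ((N - 1#) - (1# - d)) + d * (N - 1#)) ≈
                          inv12 * ((1# + (1# + s)) - N) * (1# - d)
        collect = solve 4 (λ i N s d →
          i :* (s :* (con (1 , 0) :- d) :- ((N :- con (1 , 0)) :- (con (1 , 0) :- d)) :+ d :* (N :- con (1 , 0)))
            := i :* ((con (1 , 0) :+ (con (1 , 0) :+ s)) :- N) :* (con (1 , 0) :- d)) refl inv12 N

      L : Matrix R n
      L = twoLaplacian R inv12 (completeGraph n)

      L≈cNδ-c : ∀ i k → L i k ≈ (c * N) * δ i k - c
      L≈cNδ-c i k = begin
        diag R (rowSum R (A′ R inv12 (completeGraph n))) i k - A′ R inv12 (completeGraph n) i k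
          ≈⟨ +-cong (diag≈δ* (rowSum R (A′ R inv12 (completeGraph n))) i k) (-‿cong (A′≈c[1-δ] i k)) ⟩
        δ i k * rowSum R (A′ R inv12 (completeGraph n)) i - c * (1# - δ i k)
          ≈⟨ +-congʳ (*-congˡ rowSum-A′) ⟩
        δ i k * (c * (N - 1#)) - c * (1# - δ i k)
          ≈⟨ solve 3 (λ c N d → d :* (c :* (N :- con (1 , 0))) :- c :* (con (1 , 0) :- d) := (c :* N) :* d :- c) refl c N (δ i k) ⟩
        (c * N) * δ i k - c
          ∎
        where
        rowSum-A′ : rowSum R (A′ R inv12 (completeGraph n)) i ≈ c * (N - 1#)
        rowSum-A′ = begin
          sum (A′ R inv12 (completeGraph n) i) ≈⟨ sum-cong-≋ (A′≈c[1-δ] i) ⟩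
          sum (λ k → c * (1# - δ i k))         ≈⟨ *-distribˡ-sum c (λ k → 1# - δ i k) ⟨
          c * sum (λ k → 1# - δ i k)           ≈⟨ *-congˡ (∑-1-δ i) ⟩
          c * (N - 1#)                         ∎

      constant-eigenvector : ∀ {v} → (∀ k → v k ≈ 1#) → IsEigenpair R L 0# v
      constant-eigenvector {v} v≈1 i = begin
        matVec R L v i            ≈⟨ matVec-aI-bJ (c * N) c L≈cNδ-c v i ⟩
        (c * N) * v i - c * sum v ≈⟨ +-cong (*-congˡ (v≈1 i)) (-‿cong (*-congˡ ∑v≈N)) ⟩
        (c * N) * 1# - c * N      ≈⟨ solve 2 (λ c N → (c :* N) :* con (1 , 0) :- c :* N := con (0 , 0)) refl c N ⟩
        0#                        ≈⟨ zeroˡ (v i) ⟨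
        0# * v i                  ∎
        where
        ∑v≈N : sum v ≈ N
        ∑v≈N = trans (sum-cong-≋ v≈1) (sum-replicate n)

      balanced-eigenvector : ∀ {v} → sum v ≈ 0# → IsEigenpair R L (inv12 * (N * (18 × 1# - N))) v
      balanced-eigenvector {v} ∑v≈0 i = begin
        matVec R L v i            ≈⟨ matVec-aI-bJ (c * N) c L≈cNδ-c v i ⟩
        (c * N) * v i - c * sum v ≈⟨ +-congˡ (-‿cong (*-congˡ ∑v≈0)) ⟩
        (c * N) * v i - c * 0#    ≈⟨ rearrange (18 × 1#) (v i) ⟩
        inv12 * (N * (18 × 1# - N)) * v i ∎
        where
        rearrange : ∀ t x → (inv12 * (t - N) * N) * x - inv12 * (t - N) * 0# ≈ inv12 * (N * (t - N)) * x
        rearrange = solve 4 (λ i N t x →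
          (i :* (t :- N) :* N) :* x :- i :* (t :- N) :* con (0 , 0) := i :* (N :* (t :- N)) :* x) refl inv12 N

  1#^m≈1# : ∀ m → 1# ^ m ≈ 1#
  1#^m≈1# zero    = refl
  1#^m≈1# (suc m) = trans (*-identityˡ _) (1#^m≈1# m)

  powers : ∀ {m} → Carrier → Vect R m
  powers x k = x ^ toℕ k

  geometric-sum : ∀ x m → (x - 1#) * sum (powers {m} x) ≈ x ^ m - 1#
  geometric-sum x zero    = trans (zeroʳ _) (sym (-‿inverseʳ 1#))
  geometric-sum x (suc m) = begin
    (x - 1#) * (1# + sum {m} (λ k → x * x ^ toℕ k)) ≈⟨ *-congˡ (+-congˡ (*-distribˡ-sum x (powers {m} x))) ⟨
    (x - 1#) * (1# + x * S)                     ≈⟨ solve 2 (λ x S → (x :- con (1 , 0)) :* (con (1 , 0) :+ x :* S)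
                                                        := (x :- con (1 , 0)) :+ x :* ((x :- con (1 , 0)) :* S)) refl x S ⟩
    (x - 1#) + x * ((x - 1#) * S)               ≈⟨ +-congˡ (*-congˡ (geometric-sum x m)) ⟩
    (x - 1#) + x * (x ^ m - 1#)                 ≈⟨ solve 2 (λ x y → (x :- con (1 , 0)) :+ x :* (y :- con (1 , 0))
                                                        := x :* y :- con (1 , 0)) refl x (x ^ m) ⟩
    x * x ^ m - 1#                              ∎
    where
    S : Carrier
    S = sum (powers {m} x)

  rootVector₀≈1 : ∀ {n} ω (k : Fin (suc n)) → rootVector R ω Fin.zero k ≈ 1#
  rootVector₀≈1 ω k = ^-congʳ ω (ℕ.*-zeroʳ (toℕ k))

  ∑-rootVector≈0 : IsDomain R → ∀ {n ω} → IsPrimitiveRoot R n ω →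
                   (j : Fin n) → 0 < toℕ j → sum (rootVector R ω j) ≈ 0#
  ∑-rootVector≈0 (_ , no-zero-divisors) {n} {ω} (ωⁿ≈1 , ωᵏ≉1) j 0<j =
    [ (λ x-1≈0 → ⊥-elim (ωᵏ≉1 (toℕ j) 0<j (Fin.toℕ<n j) (x∙y⁻¹≈ε⇒x≈y x 1# x-1≈0)))
    , (λ ∑≈0 → trans (sum-cong-≋ (λ k → sym (ωʲ^k≈ω^kj k))) ∑≈0)
    ]′ (no-zero-divisors (x - 1#) (sum (powers {n} x)) [x-1]∑≈0)
    where
    x : Carrier
    x = ω ^ toℕ j

    ωʲ^k≈ω^kj : ∀ k → powers x k ≈ rootVector R ω j k
    ωʲ^k≈ω^kj k = trans (^-assocʳ ω (toℕ j) (toℕ k)) (^-congʳ ω (ℕ.*-comm (toℕ j) (toℕ k)))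

    xⁿ≈1 : x ^ n ≈ 1#
    xⁿ≈1 = begin
      (ω ^ toℕ j) ^ n   ≈⟨ ^-assocʳ ω (toℕ j) n ⟩
      ω ^ (toℕ j ℕ.* n) ≈⟨ ^-congʳ ω (ℕ.*-comm (toℕ j) n) ⟩
      ω ^ (n ℕ.* toℕ j) ≈⟨ ^-assocʳ ω n (toℕ j) ⟨
      (ω ^ n) ^ toℕ j   ≈⟨ ^-congˡ (toℕ j) ωⁿ≈1 ⟩
      1# ^ toℕ j        ≈⟨ 1#^m≈1# (toℕ j) ⟩
      1#                ∎

    [x-1]∑≈0 : (x - 1#) * sum (powers {n} x) ≈ 0#
    [x-1]∑≈0 = trans (geometric-sum x n) (trans (+-congʳ xⁿ≈1) (-‿inverseʳ 1#))

corollary6p13 :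
    ∀ {c ℓ} (R : CommutativeRing c ℓ) →
    IsDomain R →
    (inv12 : CommutativeRing.Carrier R) → IsInverseOf12 R inv12 →
    (n : ℕ) → 1 ≤ n →
    (ω : CommutativeRing.Carrier R) → IsPrimitiveRoot R n ω →
    (j : Fin n) →
    IsEigenpair R (twoLaplacian R inv12 (completeGraph n))
      (eigenvalue R inv12 j) (rootVector R ω j)
corollary6p13 R _ inv12 _ n _ ω _ Fin.zero =
  CompleteGraph.constant-eigenvector R n inv12 (rootVector₀≈1 R ω)
corollary6p13 R domain inv12 _ n _ ω ω-primitive j@(Fin.suc _) =
  CompleteGraph.balanced-eigenvector R n inv12 (∑-rootVector≈0 R domain ω-primitive j (s≤s z≤n))
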